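{- As $q\to\infty$ through odd integers, $$\lim_{q\to\infty}\frac{N(4,q)}{q^3}=\lim_{q\to\infty}\frac{\mathrm{Medim}(4,q)}{q^3}=\frac1{72}.$$
   Context: A numerical semigroup is an additive submonoid $H\subseteq\mathbb N=\{0,1,\dots\}$ with finite complement. For odd $q$, $N(4,q)$ is the number of numerical semigroups containing $4$ and $q$, and $\mathrm{Medim}(4,q)$ the number of those of maximal embedding dimension $4$ (minimal generating set of exactly $4$ elements, smallest positive element $4$). -}

module Defs where

open import Data.Nat using (ℕ; zero; suc; _+_; _*_; _≤_; _<_)
open import Data.Bool using (Bool; true; false)
open import Data.Integer using (+_)
open import Data.Rational using (ℚ; 0ℚ; _/_; _-_; ∣_∣) renaming (_<_ to _<ℚ_)
open import Data.Vec using (Vec; lookup)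
open import Data.Fin using (Fin)
open import Data.Product using (Σ; ∃; ∃-syntax; _×_)
open import Relation.Binary.PropositionalEquality using (_≡_; _≢_)
open import Relation.Nullary using (¬_)

SubsetℕB : Set
SubsetℕB = ℕ → Bool

_∈ₛ_ : ℕ → SubsetℕB → Set
x ∈ₛ H = H x ≡ true

_≐_ : SubsetℕB → SubsetℕB → Set
H ≐ K = ∀ x → H x ≡ K x

record IsNumericalSemigroup (H : SubsetℕB) : Set where
  field
    zero∈ : 0 ∈ₛ H
    +-closed : ∀ a b → a ∈ₛ H → b ∈ₛ H → (a + b) ∈ₛ H
    cofinite : ∃[ c ] (∀ n → c ≤ n → n ∈ₛ H)

Contains4q : ℕ → SubsetℕB → Set
Contains4q q H = IsNumericalSemigroup H × 4 ∈ₛ H × q ∈ₛ H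

IsMinGen : SubsetℕB → ℕ → Set
IsMinGen H x = x ∈ₛ H × x ≢ 0 ×
  (∀ a b → a ∈ₛ H → b ∈ₛ H → a ≢ 0 → b ≢ 0 → a + b ≢ x)

EmbDim : SubsetℕB → ℕ → Set
EmbDim H k = Σ (Vec ℕ k) λ v →
  (∀ i j → lookup v i ≡ lookup v j → i ≡ j) ×
  (∀ i → IsMinGen H (lookup v i)) ×
  (∀ x → IsMinGen H x → ∃[ i ] lookup v i ≡ x)

Multiplicity : SubsetℕB → ℕ → Set
Multiplicity H m = m ∈ₛ H × m ≢ 0 × (∀ x → x ∈ₛ H → x ≢ 0 → m ≤ x)

Medim4q : ℕ → SubsetℕB → Set
Medim4q q H = Contains4q q H × Multiplicity H 4 × EmbDim H 4

HasCount : (SubsetℕB → Set) → ℕ → Set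
HasCount P n = Σ (Fin n → SubsetℕB) λ f →
  (∀ i → P (f i)) ×
  (∀ i j → f i ≐ f j → i ≡ j) ×
  (∀ H → P H → ∃[ i ] f i ≐ H)

Odd : ℕ → Set
Odd q = ∃[ k ] q ≡ suc (2 * k)

-- a / b as a rational (b = 0 gives 0; never used since q ≥ 1).
ratio : ℕ → ℕ → ℚ
ratio a zero = 0ℚ
ratio a (suc b) = (+ a) / suc b

OddLimit : (ℕ → ℚ) → ℚ → Set
OddLimit f L = ∀ (ε : ℚ) → 0ℚ <ℚ ε →
  ∃[ Q ] (∀ q → Q ≤ q → Odd q → ∣ f q - L ∣ <ℚ ε)

module Submission where

-- A numerical semigroup H ∋ 4 is determined by its Apéry set {0, 4a+1, 4b+2, 4c+3}
-- with respect to 4, and the triples (a, b, c) that occur are exactly the lattice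
-- points of the Kunz polyhedron b ≤ 2a, c ≤ a+b, a ≤ b+c+1, b ≤ 2c+1.  For odd
-- q = 4T + r, the condition q ∈ H cuts this down to a ≤ T (r = 1) or c ≤ T (r = 3),
-- a polytope dilated by about q/4 whose lattice points are counted fibre by fibre;
-- the count is q³/72 + O(q²).  Maximal embedding dimension 4 means multiplicity 4
-- and no Apéry element being a sum of two others, i.e. the strict Kunz inequalities,
-- so those semigroups are the shifts (a+1, b+1, c+1) of the Kunz triples for q − 4
-- and Medim(4,q) = N(4,q−4).

open import Defs
open import Data.Nat using (ℕ; _^_)
open import Data.Integer using (+_)
open import Data.Rational using (_/_)
open import Data.Product using (Σ; _×_)

module RationalLimits where

  import Algebra.Properties.AbelianGroup
  open import Data.Empty using (⊥-elim)
  open import Data.Integer as ℤ using (+[1+_]; +0; -[1+_]; +<+)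
  import Data.Integer.Properties as ℤ
  open import Data.Nat as ℕ using (suc; s≤s; z≤n; NonZero)
  import Data.Nat.Properties as ℕ
  open import Data.Nat.Coprimality using (Coprime)
  open import Data.Nat.Tactic.RingSolver using (solve-∀)
  open import Data.Product using (_×_; _,_)
  open import Data.Rational using (mkℚ; _+_; _-_; -_; _<_; *<*; ∣_∣; toℚᵘ)
  import Data.Rational.Properties as ℚ
  open import Data.Rational.Unnormalised as ℚᵘ using (mkℚᵘ)
  import Data.Rational.Unnormalised.Properties as ℚᵘ
  open import Data.Sum using (inj₁; inj₂)
  open import Relation.Binary.PropositionalEquality using (_≡_; sym; trans; cong; cong₂; subst; subst₂)

  private
    module +-group = Algebra.Properties.AbelianGroup ℚ.+-0-abelianGroup

  p<q+r⇒p-q<r : ∀ {p q r} → p < q + r → p - q < r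
  p<q+r⇒p-q<r {p} {q} {r} p<q+r = subst (p - q <_) (+-group.xyx⁻¹≈y q r) (ℚ.+-monoˡ-< (- q) p<q+r)

  ∣p-q∣<r : ∀ {p q r} → p < q + r → q < p + r → ∣ p - q ∣ < r
  ∣p-q∣<r {p} {q} {r} p<q+r q<p+r with ℚ.∣p∣≡p∨∣p∣≡-p (p - q)
  ... | inj₁ eq = subst (_< r) (sym eq) (p<q+r⇒p-q<r p<q+r)
  ... | inj₂ eq = subst (_< r) (sym (trans eq (+-group.⁻¹-anti-homo‿- p q))) (p<q+r⇒p-q<r q<p+r)

  toℚᵘ-/ : ∀ n d → toℚᵘ ((+ n) / suc d) ℚᵘ.≃ mkℚᵘ (+ n) d
  toℚᵘ-/ n d = ℚ.toℚᵘ-fromℚᵘ (mkℚᵘ (+ n) d)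

  m/u<n/v+ε : ∀ m u n v p d .(c : Coprime (suc p) (suc d)) →
              m ℕ.* (suc v ℕ.* suc d) ℕ.< (n ℕ.* suc d ℕ.+ suc p ℕ.* suc v) ℕ.* suc u →
              (+ m) / suc u < (+ n) / suc v + mkℚ +[1+ p ] d c
  m/u<n/v+ε m u n v p d c h =
    ℚ.toℚᵘ-cancel-< (ℚᵘ.<-respʳ-≃ (ℚᵘ.≃-sym sum≃) (ℚᵘ.<-respˡ-≃ (ℚᵘ.≃-sym (toℚᵘ-/ m u)) cross))
    where
    cross : mkℚᵘ (+ m) u ℚᵘ.< mkℚᵘ (+ n) v ℚᵘ.+ mkℚᵘ +[1+ p ] d
    cross = ℚᵘ.*<* (subst₂ ℤ._<_ (ℤ.pos-* m _)
      (trans (ℤ.pos-* (n ℕ.* suc d ℕ.+ suc p ℕ.* suc v) (suc u))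
        (cong (ℤ._* + suc u) (trans (ℤ.pos-+ (n ℕ.* suc d) _) (cong₂ ℤ._+_ (ℤ.pos-* n (suc d)) (ℤ.pos-* (suc p) (suc v))))))
      (+<+ h))
    sum≃ : toℚᵘ ((+ n) / suc v + mkℚ +[1+ p ] d c) ℚᵘ.≃ mkℚᵘ (+ n) v ℚᵘ.+ mkℚᵘ +[1+ p ] d
    sum≃ = ℚᵘ.≃-trans (ℚ.toℚᵘ-homo-+ ((+ n) / suc v) (mkℚ +[1+ p ] d c)) (ℚᵘ.+-congˡ (mkℚᵘ +[1+ p ] d) (toℚᵘ-/ n v))

  CubicApprox : ℕ → ℕ → (ℕ → ℕ) → Set
  CubicApprox k C X = ∀ q → Odd q → q ^ 3 ℕ.≤ k ℕ.* X q ℕ.+ C ℕ.* (q ℕ.* q) × k ℕ.* X q ℕ.≤ q ^ 3 ℕ.+ C ℕ.* (q ℕ.* q)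

  ratio-close : ∀ k X n K p d .(c : Coprime (suc p) (suc d)) → K ℕ.* suc d ℕ.< n ℕ.* (suc p ℕ.* suc k) →
                n ℕ.≤ suc k ℕ.* X ℕ.+ K → suc k ℕ.* X ℕ.≤ n ℕ.+ K →
                ∣ ratio X n - (+ 1) / suc k ∣ < mkℚ +[1+ p ] d c
  ratio-close k X ℕ.zero K p d c small _ _ = ⊥-elim (ℕ.n≮0 small)
  ratio-close k X n@(suc b) K p d c small lo hi =
    ∣p-q∣<r (m/u<n/v+ε X b 1 k p d c above) (m/u<n/v+ε 1 k X b p d c below)
    where
    open ℕ.≤-Reasoning
    sk = suc k
    sd = suc d
    sp = suc p
    above : X ℕ.* (sk ℕ.* sd) ℕ.< (1 ℕ.* sd ℕ.+ sp ℕ.* sk) ℕ.* n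
    above = begin-strict
      X ℕ.* (sk ℕ.* sd)                 ≡⟨ e₁ X sk sd ⟩
      (sk ℕ.* X) ℕ.* sd                 ≤⟨ ℕ.*-monoˡ-≤ sd hi ⟩
      (n ℕ.+ K) ℕ.* sd                  ≡⟨ ℕ.*-distribʳ-+ sd n K ⟩
      n ℕ.* sd ℕ.+ K ℕ.* sd             <⟨ ℕ.+-monoʳ-< (n ℕ.* sd) small ⟩
      n ℕ.* sd ℕ.+ n ℕ.* (sp ℕ.* sk)    ≡⟨ e₂ n sd sp sk ⟩
      (1 ℕ.* sd ℕ.+ sp ℕ.* sk) ℕ.* n    ∎
      where
      e₁ : ∀ x y z → x ℕ.* (y ℕ.* z) ≡ (y ℕ.* x) ℕ.* z
      e₁ = solve-∀
      e₂ : ∀ n x y z → n ℕ.* x ℕ.+ n ℕ.* (y ℕ.* z) ≡ (1 ℕ.* x ℕ.+ y ℕ.* z) ℕ.* n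
      e₂ = solve-∀
    below : 1 ℕ.* (n ℕ.* sd) ℕ.< (X ℕ.* sd ℕ.+ sp ℕ.* n) ℕ.* sk
    below = begin-strict
      1 ℕ.* (n ℕ.* sd)                           ≡⟨ ℕ.*-identityˡ (n ℕ.* sd) ⟩
      n ℕ.* sd                                   ≤⟨ ℕ.*-monoˡ-≤ sd lo ⟩
      (sk ℕ.* X ℕ.+ K) ℕ.* sd                    ≡⟨ ℕ.*-distribʳ-+ sd (sk ℕ.* X) K ⟩
      sk ℕ.* X ℕ.* sd ℕ.+ K ℕ.* sd               <⟨ ℕ.+-monoʳ-< (sk ℕ.* X ℕ.* sd) small ⟩
      sk ℕ.* X ℕ.* sd ℕ.+ n ℕ.* (sp ℕ.* sk)      ≡⟨ e n X sd sp sk ⟩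
      (X ℕ.* sd ℕ.+ sp ℕ.* n) ℕ.* sk             ∎
      where
      e : ∀ n x y z w → w ℕ.* x ℕ.* y ℕ.+ n ℕ.* (z ℕ.* w) ≡ (x ℕ.* y ℕ.+ z ℕ.* n) ℕ.* w
      e = solve-∀

  square-error-small : ∀ q C sd m → C ℕ.* sd ℕ.< q → C ℕ.* (q ℕ.* q) ℕ.* sd ℕ.< q ^ 3 ℕ.* suc m
  square-error-small q C sd m C·sd<q = begin-strict
    C ℕ.* (q ℕ.* q) ℕ.* sd      ≡⟨ e q C sd ⟩
    (C ℕ.* sd) ℕ.* (q ℕ.* q)    <⟨ ℕ.*-monoˡ-< (q ℕ.* q) ⦃ q²≢0 ⦄ C·sd<q ⟩
    q ℕ.* (q ℕ.* q)            ≡⟨ cong (λ z → q ℕ.* (q ℕ.* z)) (sym (ℕ.*-identityʳ q)) ⟩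
    q ^ 3                      ≤⟨ ℕ.m≤m*n (q ^ 3) (suc m) ⟩
    q ^ 3 ℕ.* suc m            ∎
    where
    open ℕ.≤-Reasoning
    e : ∀ q c s → c ℕ.* (q ℕ.* q) ℕ.* s ≡ (c ℕ.* s) ℕ.* (q ℕ.* q)
    e = solve-∀
    q²≢0 : NonZero (q ℕ.* q)
    q²≢0 = ℕ.m*n≢0 q q ⦃ ℕ.>-nonZero (ℕ.<-≤-trans (s≤s z≤n) C·sd<q) ⦄ ⦃ ℕ.>-nonZero (ℕ.<-≤-trans (s≤s z≤n) C·sd<q) ⦄

  -- For ε = (p+1)/(d+1) take Q = C(d+1) + 1: then C q² (d+1) < q³ (p+1) k, and
  -- cross-multiplying turns ∣k X − q³∣ ≤ C q² into ∣X/q³ − 1/k∣ < ε.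
  cubicApprox⇒oddLimit : ∀ k C X → CubicApprox (suc k) C X → OddLimit (λ q → ratio (X q) (q ^ 3)) ((+ 1) / suc k)
  cubicApprox⇒oddLimit k C X approx (mkℚ +0       d c) (*<* (+<+ ()))
  cubicApprox⇒oddLimit k C X approx (mkℚ -[1+ _ ] d c) (*<* ())
  cubicApprox⇒oddLimit k C X approx (mkℚ +[1+ p ] d c) _ = suc (C ℕ.* suc d) , λ q Q≤q odd →
    let lo , hi = approx q odd in
    ratio-close k (X q) (q ^ 3) (C ℕ.* (q ℕ.* q)) p d c (square-error-small q C (suc d) _ Q≤q) lo hi

open RationalLimits using (CubicApprox; cubicApprox⇒oddLimit)

open import Data.Bool using (true)
open import Data.Bool.Properties using (T-≡; ⇔→≡) renaming (_≟_ to _≟ᵇ_)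
open import Data.Empty using (⊥-elim)
open import Data.Fin as Fin using (Fin; zero; suc; toℕ; fromℕ<; punchOut)
open import Data.Fin.Properties using (any?; punchOut-injective; injective⇒≤; toℕ-injective; toℕ<n; toℕ-fromℕ<)
open import Data.List using (List; []; _++_; map; length; lookup; applyUpTo)
open import Data.List.Properties using (length-++; length-map; length-applyUpTo)
open import Data.List.Membership.Propositional using (_∈_)
open import Data.List.Membership.Propositional.Properties
  using (∈-++⁺ˡ; ∈-++⁺ʳ; ∈-++⁻; ∈-map⁺; ∈-map⁻; ∈-applyUpTo⁺; ∈-applyUpTo⁻; ∈-lookup)
import Data.List.Relation.Unary.All as All
open import Data.List.Relation.Unary.Any using (index)
open import Data.List.Relation.Unary.Any.Properties using (lookup-index)
open import Data.List.Relation.Unary.Unique.Propositional using (Unique; _∷_)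
import Data.List.Relation.Unary.Unique.Propositional.Properties as Unique
open import Data.Nat hiding (_/_)
open import Data.Nat.DivMod using (_%_; _div_; m≡m%n+[m/n]*n; m%n<n; %-distribˡ-+; [m+kn]%n≡m%n; m<n⇒m%n≡m; /-monoˡ-≤)
open import Data.Nat.Properties
open import Data.Nat.Tactic.RingSolver using (solve-∀)
open import Data.Product using (_,_; proj₁; proj₂; ∃-syntax)
open import Data.Sum using (_⊎_; inj₁; inj₂; [_,_])
import Data.Vec as Vec
open import Data.Vec.Properties using (lookup∘tabulate)
open import Function.Bundles using (Equivalence; mk⇔)
open import Function.Definitions using (Injective)
open import Relation.Binary.PropositionalEquality using (_≡_; _≢_; refl; sym; trans; cong; cong₂; subst; subst₂; module ≡-Reasoning)
open import Relation.Nullary using (¬_; yes; no; contradiction)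
open import Relation.Nullary.Decidable using (_×-dec_)
open import Relation.Unary using (Decidable)

pattern 4+ n = suc (suc (suc (suc n)))

%4-+multiple : ∀ k r → (k * 4 + r) % 4 ≡ r % 4
%4-+multiple k r = trans (cong (_% 4) (+-comm (k * 4) r)) ([m+kn]%n≡m%n r k 4)

%4-of-multiple+ : ∀ k {r} → r < 4 → (k * 4 + r) % 4 ≡ r
%4-of-multiple+ k {r} r<4 = trans (%4-+multiple k r) (m<n⇒m%n≡m r<4)

division-by-4 : ∀ x → (x div 4) * 4 + x % 4 ≡ x
division-by-4 x = trans (+-comm _ (x % 4)) (sym (m≡m%n+[m/n]*n x 4))

%4≡⇒≡div4*4+ : ∀ {x r} → x % 4 ≡ r → x ≡ (x div 4) * 4 + r
%4≡⇒≡div4*4+ {x} refl = sym (division-by-4 x)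

≡%4⇒multiple-of-4-apart : ∀ {x y} → y % 4 ≡ x % 4 → y ≤ x → ∃[ k ] x ≡ k * 4 + y
≡%4⇒multiple-of-4-apart {x} {y} same y≤x = k , (begin
  x                                 ≡⟨ sym (division-by-4 x) ⟩
  (x div 4) * 4 + x % 4             ≡⟨ cong₂ (λ u v → u * 4 + v) (sym (m∸n+n≡m (/-monoˡ-≤ 4 y≤x))) (sym same) ⟩
  (k + y div 4) * 4 + y % 4         ≡⟨ regroup k (y div 4) (y % 4) ⟩
  k * 4 + ((y div 4) * 4 + y % 4)   ≡⟨ cong (λ z → k * 4 + z) (division-by-4 y) ⟩
  k * 4 + y                         ∎)
  where
  open ≡-Reasoning
  k = x div 4 ∸ y div 4
  regroup : ∀ k l r → (k + l) * 4 + r ≡ k * 4 + (l * 4 + r)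
  regroup = solve-∀

*4+-injective : ∀ {k l} r → k * 4 + r ≡ l * 4 + r → k ≡ l
*4+-injective {k} {l} r eq = *-cancelʳ-≡ k l 4 (+-cancelʳ-≡ r (k * 4) (l * 4) eq)

*4+-cancel-≤ : ∀ {k l} r → k * 4 + r ≤ l * 4 + r → k ≤ l
*4+-cancel-≤ {k} {l} r le = *-cancelʳ-≤ k l 4 (+-cancelʳ-≤ r (k * 4) (l * 4) le)

*4+-mono-≤ : ∀ {k l} r → k ≤ l → k * 4 + r ≤ l * 4 + r
*4+-mono-≤ r k≤l = +-monoˡ-≤ r (*-monoˡ-≤ 4 k≤l)

1<4 : 1 < 4
1<4 = s≤s (s≤s z≤n)

2<4 : 2 < 4
2<4 = s≤s (s≤s (s≤s z≤n))

3<4 : 3 < 4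
3<4 = ≤-refl

Triple : Set
Triple = ℕ × ℕ × ℕ

-- (a , b , c) encodes the Apéry set {0, 4a+1, 4b+2, 4c+3} of a semigroup
-- containing 4; arguments ≥ 4 are junk and give 0.
apery : Triple → ℕ → ℕ
apery _           0      = 0
apery (a , _ , _) 1      = a * 4 + 1
apery (_ , b , _) 2      = b * 4 + 2
apery (_ , _ , c) 3      = c * 4 + 3
apery _           (4+ _) = 0

semigroupOf : Triple → SubsetℕB
semigroupOf t x = apery t (x % 4) ≤ᵇ x

∈-semigroupOf⁺ : ∀ t x → apery t (x % 4) ≤ x → x ∈ₛ semigroupOf t
∈-semigroupOf⁺ t x le = Equivalence.to T-≡ (≤⇒≤ᵇ le)

∈-semigroupOf⁻ : ∀ t x → x ∈ₛ semigroupOf t → apery t (x % 4) ≤ x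
∈-semigroupOf⁻ t x x∈ = ≤ᵇ⇒≤ _ x (Equivalence.from T-≡ x∈)

apery-%4 : ∀ t {i} → i < 4 → apery t i % 4 ≡ i
apery-%4 t           {0}    _ = refl
apery-%4 (a , _ , _) {1}    _ = %4-of-multiple+ a 1<4
apery-%4 (_ , b , _) {2}    _ = %4-of-multiple+ b 2<4
apery-%4 (_ , _ , c) {3}    _ = %4-of-multiple+ c 3<4
apery-%4 t           {4+ _} (s≤s (s≤s (s≤s (s≤s ()))))

apery-∈ : ∀ t {i} → i < 4 → apery t i ∈ₛ semigroupOf t
apery-∈ t {i} i<4 = ∈-semigroupOf⁺ t (apery t i) (≤-reflexive (cong (apery t) (apery-%4 t i<4)))

apery-≤ : ∀ t t' {i} → i < 4 → apery t i ∈ₛ semigroupOf t' → apery t' i ≤ apery t i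
apery-≤ t t' {i} i<4 ∈t' = subst (λ r → apery t' r ≤ apery t i) (apery-%4 t i<4) (∈-semigroupOf⁻ t' (apery t i) ∈t')

semigroupOf-injective : ∀ {t t'} → semigroupOf t ≐ semigroupOf t' → t ≡ t'
semigroupOf-injective {a , b , c} {a' , b' , c'} eq =
  cong₂ _,_ (*4+-injective 1 (same 1 1<4)) (cong₂ _,_ (*4+-injective 2 (same 2 2<4)) (*4+-injective 3 (same 3 3<4)))
  where
  t = a , b , c
  t' = a' , b' , c'
  same : ∀ i → i < 4 → apery t i ≡ apery t' i
  same i i<4 = ≤-antisym
    (apery-≤ t' t i<4 (trans (eq (apery t' i)) (apery-∈ t' i<4)))
    (apery-≤ t t' i<4 (trans (sym (eq (apery t i))) (apery-∈ t i<4)))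

IsKunz : Triple → Set
IsKunz (a , b , c) = b ≤ a + a × c ≤ a + b × a ≤ suc (b + c) × b ≤ suc (c + c)

SubadditiveApery : Triple → Set
SubadditiveApery t = ∀ i j → i < 4 → j < 4 → apery t ((i + j) % 4) ≤ apery t i + apery t j

private
  sum₁₁ : ∀ a → (a * 4 + 1) + (a * 4 + 1) ≡ (a + a) * 4 + 2
  sum₁₁ = solve-∀
  sum₁₂ : ∀ a b → (a * 4 + 1) + (b * 4 + 2) ≡ (a + b) * 4 + 3
  sum₁₂ = solve-∀
  sum₂₃ : ∀ b c → (b * 4 + 2) + (c * 4 + 3) ≡ suc (b + c) * 4 + 1
  sum₂₃ = solve-∀
  sum₃₃ : ∀ c → (c * 4 + 3) + (c * 4 + 3) ≡ suc (c + c) * 4 + 2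
  sum₃₃ = solve-∀

-- Adding residue 0 is trivial and 1+3, 2+2, 3+1 land in class 0, whose Apéry
-- element is 0; the remaining cases are the four Kunz inequalities.
isKunz⇒subadditive : ∀ t → IsKunz t → SubadditiveApery t
isKunz⇒subadditive (a , b , c) (b≤2a , c≤a+b , a≤b+c+1 , b≤2c+1) = go
  where
  go : SubadditiveApery (a , b , c)
  go 0 j _ j<4 = ≤-reflexive (cong (apery _) (m<n⇒m%n≡m j<4))
  go 1 0 _ _ = m≤m+n _ 0
  go 2 0 _ _ = m≤m+n _ 0
  go 3 0 _ _ = m≤m+n _ 0
  go 1 1 _ _ = ≤-trans (*4+-mono-≤ 2 b≤2a) (≤-reflexive (sym (sum₁₁ a)))
  go 1 2 _ _ = ≤-trans (*4+-mono-≤ 3 c≤a+b) (≤-reflexive (sym (sum₁₂ a b)))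
  go 1 3 _ _ = z≤n
  go 2 1 _ _ = ≤-trans (*4+-mono-≤ 3 c≤a+b) (≤-reflexive (trans (sym (sum₁₂ a b)) (+-comm (a * 4 + 1) (b * 4 + 2))))
  go 2 2 _ _ = z≤n
  go 2 3 _ _ = ≤-trans (*4+-mono-≤ 1 a≤b+c+1) (≤-reflexive (sym (sum₂₃ b c)))
  go 3 1 _ _ = z≤n
  go 3 2 _ _ = ≤-trans (*4+-mono-≤ 1 a≤b+c+1) (≤-reflexive (trans (sym (sum₂₃ b c)) (+-comm (b * 4 + 2) (c * 4 + 3))))
  go 3 3 _ _ = ≤-trans (*4+-mono-≤ 2 b≤2c+1) (≤-reflexive (sym (sum₃₃ c)))
  go (4+ _) _ (s≤s (s≤s (s≤s (s≤s ())))) _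
  go (suc _) (4+ _) _ (s≤s (s≤s (s≤s (s≤s ()))))

subadditive⇒isKunz : ∀ t → SubadditiveApery t → IsKunz t
subadditive⇒isKunz (a , b , c) sub =
    *4+-cancel-≤ 2 (≤-trans (sub 1 1 1<4 1<4) (≤-reflexive (sum₁₁ a)))
  , *4+-cancel-≤ 3 (≤-trans (sub 1 2 1<4 2<4) (≤-reflexive (sum₁₂ a b)))
  , *4+-cancel-≤ 1 (≤-trans (sub 2 3 2<4 3<4) (≤-reflexive (sum₂₃ b c)))
  , *4+-cancel-≤ 2 (≤-trans (sub 3 3 3<4 3<4) (≤-reflexive (sum₃₃ c)))

module _ {P : ℕ → Set} (P? : Decidable P) where

  private
    search : ∀ n → (∀ m → m < n → ¬ P m) ⊎ ∃[ e ] P e × (∀ x → P x → e ≤ x)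
    search zero = inj₁ λ _ ()
    search (suc n) with search n
    ... | inj₂ found = inj₂ found
    ... | inj₁ none with P? n
    ...   | yes pn = inj₂ (n , pn , λ x px → ≮⇒≥ λ x<n → none x x<n px)
    ...   | no ¬pn = inj₁ λ m m<1+n pm →
      [ (λ m<n → none m m<n pm) , (λ { refl → ¬pn pm }) ] (m≤n⇒m<n∨m≡n (s≤s⁻¹ m<1+n))

  least-witness : ∀ {w} → P w → ∃[ e ] P e × (∀ x → P x → e ≤ x)
  least-witness {w} pw with search (suc w)
  ... | inj₁ none  = ⊥-elim (none w ≤-refl pw)
  ... | inj₂ found = found

semigroupOf-isNumericalSemigroup : ∀ t → IsKunz t → IsNumericalSemigroup (semigroupOf t)
semigroupOf-isNumericalSemigroup t@(a , b , c) kunz = record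
  { zero∈    = refl
  ; +-closed = λ x y x∈ y∈ → ∈-semigroupOf⁺ t (x + y) (closed x y x∈ y∈)
  ; cofinite = suc bound , λ n 1+bound≤n →
      ∈-semigroupOf⁺ t n (≤-trans (apery≤bound (n % 4)) (≤-trans (n≤1+n bound) 1+bound≤n))
  }
  where
  closed : ∀ x y → x ∈ₛ semigroupOf t → y ∈ₛ semigroupOf t → apery t ((x + y) % 4) ≤ x + y
  closed x y x∈ y∈ = begin
    apery t ((x + y) % 4)             ≡⟨ cong (apery t) (%-distribˡ-+ x y 4) ⟩
    apery t ((x % 4 + y % 4) % 4)     ≤⟨ isKunz⇒subadditive t kunz (x % 4) (y % 4) (m%n<n x 4) (m%n<n y 4) ⟩
    apery t (x % 4) + apery t (y % 4) ≤⟨ +-mono-≤ (∈-semigroupOf⁻ t x x∈) (∈-semigroupOf⁻ t y y∈) ⟩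
    x + y                             ∎
    where open ≤-Reasoning
  bound = (a + b + c) * 4 + 3
  apery≤bound : ∀ i → apery t i ≤ bound
  apery≤bound 0      = z≤n
  apery≤bound 1      = +-mono-≤ (*-monoˡ-≤ 4 (≤-trans (m≤m+n a b) (m≤m+n (a + b) c))) (s≤s z≤n)
  apery≤bound 2      = +-mono-≤ (*-monoˡ-≤ 4 (≤-trans (m≤n+m b a) (m≤m+n (a + b) c))) (s≤s (s≤s z≤n))
  apery≤bound 3      = +-mono-≤ (*-monoˡ-≤ 4 (m≤n+m c (a + b))) ≤-refl
  apery≤bound (4+ _) = z≤n

module AperyTriple {H : SubsetℕB} (H-semigroup : IsNumericalSemigroup H) (4∈H : 4 ∈ₛ H) where
  open IsNumericalSemigroup H-semigroup

  +4k-closed : ∀ k {x} → x ∈ₛ H → (k * 4 + x) ∈ₛ H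
  +4k-closed zero    x∈ = x∈
  +4k-closed (suc k) x∈ = +-closed 4 _ 4∈H (+4k-closed k x∈)

  InClass : ℕ → ℕ → Set
  InClass i x = x ∈ₛ H × x % 4 ≡ i

  -- Cofiniteness puts c * 4 + i into every residue class.
  leastInClass : ∀ i → i < 4 → ∃[ e ] InClass i e × (∀ x → InClass i x → e ≤ x)
  leastInClass i i<4 = least-witness (λ x → (H x ≟ᵇ true) ×-dec (x % 4 ≟ i))
    (proj₂ cofinite (c * 4 + i) (≤-trans (m≤m*n c 4) (m≤m+n (c * 4) i)) , %4-of-multiple+ c i<4)
    where c = proj₁ cofinite

  aperyTriple : Triple
  aperyTriple = proj₁ (leastInClass 1 1<4) div 4 , proj₁ (leastInClass 2 2<4) div 4 , proj₁ (leastInClass 3 3<4) div 4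

  private
    least≡apery : ∀ i (i<4 : i < 4) → proj₁ (leastInClass i i<4) ≡ apery aperyTriple i
    least≡apery 0 i<4 = n≤0⇒n≡0 (proj₂ (proj₂ (leastInClass 0 i<4)) 0 (zero∈ , refl))
    least≡apery 1 _ = %4≡⇒≡div4*4+ (proj₂ (proj₁ (proj₂ (leastInClass 1 1<4))))
    least≡apery 2 _ = %4≡⇒≡div4*4+ (proj₂ (proj₁ (proj₂ (leastInClass 2 2<4))))
    least≡apery 3 _ = %4≡⇒≡div4*4+ (proj₂ (proj₁ (proj₂ (leastInClass 3 3<4))))
    least≡apery (4+ _) (s≤s (s≤s (s≤s (s≤s ()))))

  ∈⇒apery≤ : ∀ x → x ∈ₛ H → apery aperyTriple (x % 4) ≤ x
  ∈⇒apery≤ x x∈ = subst (_≤ x) (least≡apery (x % 4) (m%n<n x 4))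
    (proj₂ (proj₂ (leastInClass (x % 4) (m%n<n x 4))) x (x∈ , refl))

  apery≤⇒∈ : ∀ x → apery aperyTriple (x % 4) ≤ x → x ∈ₛ H
  apery≤⇒∈ x le with leastInClass (x % 4) (m%n<n x 4) | least≡apery (x % 4) (m%n<n x 4)
  ... | e , (e∈ , e%4) , _ | e≡apery with ≡%4⇒multiple-of-4-apart e%4 (subst (_≤ x) (sym e≡apery) le)
  ...   | k , refl = +4k-closed k e∈

  semigroupOf-aperyTriple : semigroupOf aperyTriple ≐ H
  semigroupOf-aperyTriple x = ⇔→≡ (mk⇔ (λ x∈ → apery≤⇒∈ x (∈-semigroupOf⁻ aperyTriple x x∈))
                                        (λ x∈ → ∈-semigroupOf⁺ aperyTriple x (∈⇒apery≤ x x∈)))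

  aperyTriple-isKunz : IsKunz aperyTriple
  aperyTriple-isKunz = subadditive⇒isKunz aperyTriple λ i j i<4 j<4 →
    let s = apery aperyTriple i + apery aperyTriple j in
    subst (λ r → apery aperyTriple r ≤ s) (residue i j i<4 j<4)
      (∈⇒apery≤ s (+-closed _ _ (apery∈H i<4) (apery∈H j<4)))
    where
    apery∈H : ∀ {i} → i < 4 → apery aperyTriple i ∈ₛ H
    apery∈H i<4 = trans (sym (semigroupOf-aperyTriple _)) (apery-∈ aperyTriple i<4)
    residue : ∀ i j → i < 4 → j < 4 → (apery aperyTriple i + apery aperyTriple j) % 4 ≡ (i + j) % 4
    residue i j i<4 j<4 = trans (%-distribˡ-+ (apery aperyTriple i) _ 4)
      (cong₂ (λ u v → (u + v) % 4) (apery-%4 aperyTriple i<4) (apery-%4 aperyTriple j<4))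

∑ : ℕ → (ℕ → ℕ) → ℕ
∑ zero    f = 0
∑ (suc n) f = ∑ n f + f n

syntax ∑ n (λ i → e) = ∑[ i < n ] e

∑-cong : ∀ n {f g : ℕ → ℕ} → (∀ i → i < n → f i ≡ g i) → ∑ n f ≡ ∑ n g
∑-cong zero    f≗g = refl
∑-cong (suc n) f≗g = cong₂ _+_ (∑-cong n λ i i<n → f≗g i (m<n⇒m<1+n i<n)) (f≗g n ≤-refl)

∑-+ : ∀ m n (f : ℕ → ℕ) → ∑[ i < m + n ] f i ≡ ∑[ i < m ] f i + ∑[ j < n ] f (m + j)
∑-+ m zero    f = trans (cong (λ k → ∑ k f) (+-identityʳ m)) (sym (+-identityʳ _))
∑-+ m (suc n) f = begin
  ∑[ i < m + suc n ] f i                           ≡⟨ cong (λ k → ∑ k f) (+-suc m n) ⟩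
  ∑[ i < m + n ] f i + f (m + n)                   ≡⟨ cong (_+ f (m + n)) (∑-+ m n f) ⟩
  ∑[ i < m ] f i + ∑[ j < n ] f (m + j) + f (m + n) ≡⟨ +-assoc (∑ m f) _ _ ⟩
  ∑[ i < m ] f i + (∑[ j < n ] f (m + j) + f (m + n)) ∎
  where open ≡-Reasoning

∑-suc : ∀ n (f : ℕ → ℕ) → ∑[ i < suc n ] f i ≡ f 0 + ∑[ i < n ] f (suc i)
∑-suc = ∑-+ 1

∑-*ˡ : ∀ n k (f : ℕ → ℕ) → ∑[ i < n ] (k * f i) ≡ k * ∑[ i < n ] f i
∑-*ˡ zero    k f = sym (*-zeroʳ k)
∑-*ˡ (suc n) k f = trans (cong (_+ k * f n) (∑-*ˡ n k f)) (sym (*-distribˡ-+ k (∑ n f) (f n)))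

∑-sandwich : ∀ (f L U : ℕ → ℕ) → L 0 ≤ f 0 → f 0 ≤ U 0 →
             (∀ n → L (suc n) ≤ L n + f (suc n)) → (∀ n → U n + f (suc n) ≤ U (suc n)) →
             ∀ n → L n ≤ ∑[ i < suc n ] f i × ∑[ i < suc n ] f i ≤ U n
∑-sandwich f L U L≤f U≥f L-step U-step zero    = L≤f , U≥f
∑-sandwich f L U L≤f U≥f L-step U-step (suc n) =
  let lo , hi = ∑-sandwich f L U L≤f U≥f L-step U-step n in
  ≤-trans (L-step n) (+-monoˡ-≤ (f (suc n)) lo) , ≤-trans (+-monoˡ-≤ (f (suc n)) hi) (U-step n)

triangle : ∀ n → (∑[ j < n ] (n ∸ j)) * 2 ≡ n * suc n
triangle zero    = refl
triangle (suc n) = begin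
  (∑[ j < suc n ] (suc n ∸ j)) * 2   ≡⟨ cong (_* 2) (∑-suc n (suc n ∸_)) ⟩
  (suc n + ∑[ j < n ] (n ∸ j)) * 2   ≡⟨ *-distribʳ-+ 2 (suc n) _ ⟩
  suc n * 2 + (∑[ j < n ] (n ∸ j)) * 2 ≡⟨ cong (λ z → suc n * 2 + z) (triangle n) ⟩
  suc n * 2 + n * suc n              ≡⟨ e n ⟩
  suc n * suc (suc n)                ∎
  where
  open ≡-Reasoning
  e : ∀ n → suc n * 2 + n * suc n ≡ suc n * suc (suc n)
  e = solve-∀

triangle-closed : ∀ n m → n * suc n ≡ m * 2 → ∑[ j < n ] (n ∸ j) ≡ m
triangle-closed n m eq = *-cancelʳ-≡ _ m 2 (trans (triangle n) eq)

-- Polynomial inequalities are proved by exhibiting the slack, leaving the identity to the ring solver.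
≤-slack : ∀ {m n} k → m + k ≡ n → m ≤ n
≤-slack {m} k refl = m≤m+n m k

lookup-injective : ∀ {A : Set} {xs : List A} → Unique xs → ∀ i j → lookup xs i ≡ lookup xs j → i ≡ j
lookup-injective (_ ∷ _)     zero    zero    _  = refl
lookup-injective (x∉ ∷ _)    zero    (suc j) eq = ⊥-elim (All.lookup x∉ (∈-lookup j) eq)
lookup-injective (x∉ ∷ _)    (suc i) zero    eq = ⊥-elim (All.lookup x∉ (∈-lookup i) (sym eq))
lookup-injective (_ ∷ uniq)  (suc i) (suc j) eq = cong suc (lookup-injective uniq i j eq)

hasCount-fromList : (P : SubsetℕB → Set) (ts : List Triple) → Unique ts →
                    (∀ {t} → t ∈ ts → P (semigroupOf t)) →
                    (∀ H → P H → ∃[ t ] t ∈ ts × semigroupOf t ≐ H) →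
                    HasCount P (length ts)
hasCount-fromList P ts uniq sound complete =
    (λ i → semigroupOf (lookup ts i))
  , (λ i → sound (∈-lookup i))
  , (λ i j eq → lookup-injective uniq i j (semigroupOf-injective eq))
  , λ H pH → let t , t∈ , t≐H = complete H pH in
      index t∈ , λ x → trans (cong (λ u → semigroupOf u x) (sym (lookup-index t∈))) (t≐H x)

concatUpTo : ∀ {A : Set} → ℕ → (ℕ → List A) → List A
concatUpTo zero    f = []
concatUpTo (suc n) f = concatUpTo n f ++ f n

module _ {A : Set} where

  ∈-concatUpTo⁺ : ∀ {x : A} {n i} (f : ℕ → List A) → i < n → x ∈ f i → x ∈ concatUpTo n f
  ∈-concatUpTo⁺ {n = suc n} f i<1+n x∈ with m≤n⇒m<n∨m≡n (s≤s⁻¹ i<1+n)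
  ... | inj₁ i<n  = ∈-++⁺ˡ (∈-concatUpTo⁺ f i<n x∈)
  ... | inj₂ refl = ∈-++⁺ʳ (concatUpTo n f) x∈

  ∈-concatUpTo⁻ : ∀ {x : A} n (f : ℕ → List A) → x ∈ concatUpTo n f → ∃[ i ] i < n × x ∈ f i
  ∈-concatUpTo⁻ (suc n) f x∈ with ∈-++⁻ (concatUpTo n f) x∈
  ... | inj₂ x∈fn = n , ≤-refl , x∈fn
  ... | inj₁ x∈   = let i , i<n , x∈fi = ∈-concatUpTo⁻ n f x∈ in i , m<n⇒m<1+n i<n , x∈fi

  length-concatUpTo : ∀ n (f : ℕ → List A) → length (concatUpTo n f) ≡ ∑[ i < n ] length (f i)
  length-concatUpTo zero    f = refl
  length-concatUpTo (suc n) f = trans (length-++ (concatUpTo n f)) (cong (_+ length (f n)) (length-concatUpTo n f))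

  concatUpTo-unique : ∀ n (f : ℕ → List A) (key : A → ℕ) → (∀ {i x} → x ∈ f i → key x ≡ i) →
                      (∀ i → Unique (f i)) → Unique (concatUpTo n f)
  concatUpTo-unique zero    f key keyed uniq = Unique.[]
  concatUpTo-unique (suc n) f key keyed uniq =
    Unique.++⁺ (concatUpTo-unique n f key keyed uniq) (uniq n) λ (x∈ , x∈fn) →
      let i , i<n , x∈fi = ∈-concatUpTo⁻ n f x∈ in <-irrefl (trans (sym (keyed x∈fi)) (keyed x∈fn)) i<n

range : ℕ → ℕ → List ℕ
range l u = applyUpTo (λ i → l + i) (suc u ∸ l)

∈-range⁺ : ∀ {l u b} → l ≤ b → b ≤ u → b ∈ range l u
∈-range⁺ {l} {u} l≤b b≤u =
  subst (_∈ range l u) (m+[n∸m]≡n l≤b) (∈-applyUpTo⁺ (λ i → l + i) (∸-monoˡ-< (s≤s b≤u) l≤b))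

∈-range⁻ : ∀ {l u b} → b ∈ range l u → l ≤ b × b ≤ u
∈-range⁻ {l} {u} b∈ with ∈-applyUpTo⁻ (λ i → l + i) b∈
... | i , i<n , refl = m≤m+n l i , s≤s⁻¹ (subst (l + i <_) (m+[n∸m]≡n l≤1+u) (+-monoʳ-< l i<n))
  where
  l≤1+u : l ≤ suc u
  l≤1+u = <⇒≤ (m∸n≢0⇒n<m λ eq → n≮0 (subst (i <_) eq i<n))

range-unique : ∀ l u → Unique (range l u)
range-unique l u = Unique.applyUpTo⁺₁ _ (suc u ∸ l) λ i<j _ eq → <⇒≢ i<j (+-cancelˡ-≡ l _ _ eq)

length-range : ∀ l u → length (range l u) ≡ suc u ∸ l
length-range l u = length-applyUpTo (λ i → l + i) (suc u ∸ l)

kunzLower : ℕ → ℕ → ℕ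
kunzLower a c = (c ∸ a) ⊔ (a ∸ suc c)

kunzUpper : ℕ → ℕ → ℕ
kunzUpper a c = (a + a) ⊓ suc (c + c)

kunzCount : ℕ → ℕ → ℕ
kunzCount a c = suc (kunzUpper a c) ∸ kunzLower a c

isKunz⇒bounds : ∀ {a b c} → IsKunz (a , b , c) → kunzLower a c ≤ b × b ≤ kunzUpper a c
isKunz⇒bounds {a} {b} {c} (b≤2a , c≤a+b , a≤b+c+1 , b≤2c+1) =
    ⊔-lub (m≤n+o⇒m∸n≤o c a c≤a+b) (m≤n+o⇒m∸n≤o a (suc c) (subst (a ≤_) (cong suc (+-comm b c)) a≤b+c+1))
  , ⊓-glb b≤2a b≤2c+1

bounds⇒isKunz : ∀ {a b c} → kunzLower a c ≤ b → b ≤ kunzUpper a c → IsKunz (a , b , c)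
bounds⇒isKunz {a} {b} {c} lower≤b b≤upper =
    m≤n⊓o⇒m≤n (a + a) _ b≤upper
  , ≤-trans (m≤n+m∸n c a) (+-monoʳ-≤ a (m⊔n≤o⇒m≤o (c ∸ a) _ lower≤b))
  , subst (a ≤_) (cong suc (+-comm c b)) (≤-trans (m≤n+m∸n a (suc c)) (+-monoʳ-≤ (suc c) (m⊔n≤o⇒n≤o _ (a ∸ suc c) lower≤b)))
  , m≤n⊓o⇒m≤o _ (suc (c + c)) b≤upper

kunzFibre : ℕ → ℕ → List Triple
kunzFibre a c = map (λ b → a , b , c) (range (kunzLower a c) (kunzUpper a c))

∈-kunzFibre⁺ : ∀ {a b c} → IsKunz (a , b , c) → (a , b , c) ∈ kunzFibre a c
∈-kunzFibre⁺ kunz = let l , u = isKunz⇒bounds kunz in ∈-map⁺ _ (∈-range⁺ l u)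

∈-kunzFibre⁻ : ∀ {a c t} → t ∈ kunzFibre a c → ∃[ b ] t ≡ (a , b , c) × IsKunz (a , b , c)
∈-kunzFibre⁻ t∈ with ∈-map⁻ _ t∈
... | b , b∈ , refl = let l , u = ∈-range⁻ b∈ in b , refl , bounds⇒isKunz l u

kunzFibre-unique : ∀ a c → Unique (kunzFibre a c)
kunzFibre-unique a c = Unique.map⁺ (λ { refl → refl }) (range-unique (kunzLower a c) (kunzUpper a c))

length-kunzFibre : ∀ a c → length (kunzFibre a c) ≡ kunzCount a c
length-kunzFibre a c = trans (length-map _ (range (kunzLower a c) (kunzUpper a c))) (length-range (kunzLower a c) (kunzUpper a c))

isKunz⇒c≤3a : ∀ {a b c} → IsKunz (a , b , c) → c ≤ a * 3
isKunz⇒c≤3a {a} (b≤2a , c≤a+b , _) = ≤-trans c≤a+b (≤-trans (+-monoʳ-≤ a b≤2a) (≤-reflexive (3a a)))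
  where
  3a : ∀ a → a + (a + a) ≡ a * 3
  3a = solve-∀

isKunz⇒a≤3c+2 : ∀ {a b c} → IsKunz (a , b , c) → a ≤ 2 + c * 3
isKunz⇒a≤3c+2 {c = c} (_ , _ , a≤b+c+1 , b≤2c+1) = ≤-trans a≤b+c+1 (≤-trans (s≤s (+-monoˡ-≤ c b≤2c+1)) (≤-reflexive (3c+2 c)))
  where
  3c+2 : ∀ c → suc (suc (c + c) + c) ≡ 2 + c * 3
  3c+2 = solve-∀

kunzTriplesA : ℕ → List Triple
kunzTriplesA T = concatUpTo (suc T) λ a → concatUpTo (suc (a * 3)) λ c → kunzFibre a c

kunzTriplesC : ℕ → List Triple
kunzTriplesC T = concatUpTo (suc T) λ c → concatUpTo (3 + c * 3) λ a → kunzFibre a c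

∈-kunzTriplesA⁺ : ∀ {T a b c} → IsKunz (a , b , c) → a ≤ T → (a , b , c) ∈ kunzTriplesA T
∈-kunzTriplesA⁺ kunz a≤T = ∈-concatUpTo⁺ _ (s≤s a≤T) (∈-concatUpTo⁺ _ (s≤s (isKunz⇒c≤3a kunz)) (∈-kunzFibre⁺ kunz))

∈-kunzTriplesA⁻ : ∀ {T t} → t ∈ kunzTriplesA T → IsKunz t × proj₁ t ≤ T
∈-kunzTriplesA⁻ {T} t∈ with ∈-concatUpTo⁻ (suc T) _ t∈
... | a , a<1+T , t∈a with ∈-concatUpTo⁻ (suc (a * 3)) _ t∈a
...   | c , _ , t∈ac with ∈-kunzFibre⁻ t∈ac
...     | b , refl , kunz = kunz , s≤s⁻¹ a<1+T

∈-kunzTriplesC⁺ : ∀ {T a b c} → IsKunz (a , b , c) → c ≤ T → (a , b , c) ∈ kunzTriplesC T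
∈-kunzTriplesC⁺ kunz c≤T = ∈-concatUpTo⁺ _ (s≤s c≤T) (∈-concatUpTo⁺ _ (s≤s (isKunz⇒a≤3c+2 kunz)) (∈-kunzFibre⁺ kunz))

∈-kunzTriplesC⁻ : ∀ {T t} → t ∈ kunzTriplesC T → IsKunz t × proj₂ (proj₂ t) ≤ T
∈-kunzTriplesC⁻ {T} t∈ with ∈-concatUpTo⁻ (suc T) _ t∈
... | c , c<1+T , t∈c with ∈-concatUpTo⁻ (3 + c * 3) _ t∈c
...   | a , _ , t∈ac with ∈-kunzFibre⁻ t∈ac
...     | b , refl , kunz = kunz , s≤s⁻¹ c<1+T

kunzTriplesA-unique : ∀ T → Unique (kunzTriplesA T)
kunzTriplesA-unique T = concatUpTo-unique (suc T) _ proj₁ outer λ a →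
  concatUpTo-unique (suc (a * 3)) _ (λ t → proj₂ (proj₂ t)) inner λ c → kunzFibre-unique a c
  where
  inner : ∀ {a c t} → t ∈ kunzFibre a c → proj₂ (proj₂ t) ≡ c
  inner t∈ with ∈-kunzFibre⁻ t∈
  ... | _ , refl , _ = refl
  outer : ∀ {a t} → t ∈ concatUpTo (suc (a * 3)) (kunzFibre a) → proj₁ t ≡ a
  outer {a} t∈ with ∈-concatUpTo⁻ (suc (a * 3)) _ t∈
  ... | c , _ , t∈ac with ∈-kunzFibre⁻ t∈ac
  ...   | _ , refl , _ = refl

kunzTriplesC-unique : ∀ T → Unique (kunzTriplesC T)
kunzTriplesC-unique T = concatUpTo-unique (suc T) _ (λ t → proj₂ (proj₂ t)) outer λ c →
  concatUpTo-unique (3 + c * 3) _ proj₁ inner λ a → kunzFibre-unique a c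
  where
  inner : ∀ {c a t} → t ∈ kunzFibre a c → proj₁ t ≡ a
  inner t∈ with ∈-kunzFibre⁻ t∈
  ... | _ , refl , _ = refl
  outer : ∀ {c t} → t ∈ concatUpTo (3 + c * 3) (λ a → kunzFibre a c) → proj₂ (proj₂ t) ≡ c
  outer {c} t∈ with ∈-concatUpTo⁻ (3 + c * 3) _ t∈
  ... | a , _ , t∈ac with ∈-kunzFibre⁻ t∈ac
  ...   | _ , refl , _ = refl

length-kunzTriplesA : ∀ T → length (kunzTriplesA T) ≡ ∑[ a < suc T ] ∑[ c < suc (a * 3) ] kunzCount a c
length-kunzTriplesA T = trans (length-concatUpTo (suc T) _) (∑-cong (suc T) λ a _ →
  trans (length-concatUpTo (suc (a * 3)) _) (∑-cong (suc (a * 3)) λ c _ → length-kunzFibre a c))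

length-kunzTriplesC : ∀ T → length (kunzTriplesC T) ≡ ∑[ c < suc T ] ∑[ a < 3 + c * 3 ] kunzCount a c
length-kunzTriplesC T = trans (length-concatUpTo (suc T) _) (∑-cong (suc T) λ c _ →
  trans (length-concatUpTo (3 + c * 3) _) (∑-cong (3 + c * 3) λ a _ → length-kunzFibre a c))

odd⇒%4≡1⊎3 : ∀ {q} → Odd q → q % 4 ≡ 1 ⊎ q % 4 ≡ 3
odd⇒%4≡1⊎3 (k , refl) = go k
  where
  go : ∀ k → suc (2 * k) % 4 ≡ 1 ⊎ suc (2 * k) % 4 ≡ 3
  go 0 = inj₁ refl
  go 1 = inj₂ refl
  go (suc (suc k)) = subst (λ n → n % 4 ≡ 1 ⊎ n % 4 ≡ 3) (sym (e k)) (go k)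
    where
    e : ∀ k → suc (2 * suc (suc k)) ≡ 4 + suc (2 * k)
    e = solve-∀

kunzTriplesByResidue : ℕ → ℕ → List Triple
kunzTriplesByResidue 1 T = kunzTriplesA T
kunzTriplesByResidue 3 T = kunzTriplesC T
kunzTriplesByResidue _ _ = []

-- For odd q, the Kunz triples whose semigroup contains q (empty for even q).
kunzList : ℕ → List Triple
kunzList q = kunzTriplesByResidue (q % 4) (q div 4)

kunzList-unique : ∀ q → Unique (kunzList q)
kunzList-unique q with q % 4
... | 0      = Unique.[]
... | 1      = kunzTriplesA-unique (q div 4)
... | 2      = Unique.[]
... | 3      = kunzTriplesC-unique (q div 4)
... | 4+ _   = Unique.[]

∈-kunzList⁻ : ∀ {q a b c} → (a , b , c) ∈ kunzList q → IsKunz (a , b , c) × apery (a , b , c) (q % 4) ≤ q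
∈-kunzList⁻ {q} t∈ with q % 4 | division-by-4 q
... | 1 | q≡ = let kunz , a≤T = ∈-kunzTriplesA⁻ {q div 4} t∈ in kunz , subst (_ ≤_) q≡ (*4+-mono-≤ 1 a≤T)
... | 3 | q≡ = let kunz , c≤T = ∈-kunzTriplesC⁻ {q div 4} t∈ in kunz , subst (_ ≤_) q≡ (*4+-mono-≤ 3 c≤T)

∈-kunzList⁺ : ∀ {q a b c} → q % 4 ≡ 1 ⊎ q % 4 ≡ 3 → IsKunz (a , b , c) → apery (a , b , c) (q % 4) ≤ q →
              (a , b , c) ∈ kunzList q
∈-kunzList⁺ {q} odd kunz le with q % 4 | division-by-4 q
∈-kunzList⁺ (inj₁ ()) _ _ | 0 | _
∈-kunzList⁺ {q} _ kunz le | 1 | q≡ = ∈-kunzTriplesA⁺ {q div 4} kunz (*4+-cancel-≤ 1 (subst (_ ≤_) (sym q≡) le))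
∈-kunzList⁺ (inj₁ ()) _ _ | 2 | _
∈-kunzList⁺ {q} _ kunz le | 3 | q≡ = ∈-kunzTriplesC⁺ {q div 4} kunz (*4+-cancel-≤ 3 (subst (_ ≤_) (sym q≡) le))
∈-kunzList⁺ (inj₁ ()) _ _ | 4+ _ | _

kunzCount-below : ∀ {a c} → c < a → kunzCount a c ≡ (c * 3 + 3) ∸ a
kunzCount-below {a} {c} c<a = begin
  suc (kunzUpper a c) ∸ kunzLower a c           ≡⟨ cong₂ (λ u l → suc u ∸ l) upper lower ⟩
  suc (suc (c + c)) ∸ (a ∸ suc c)               ≡⟨ sym ([m+n]∸[m+o]≡n∸o (suc c) _ _) ⟩
  (suc c + suc (suc (c + c))) ∸ (suc c + (a ∸ suc c)) ≡⟨ cong₂ _∸_ (e c) (m+[n∸m]≡n c<a) ⟩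
  (c * 3 + 3) ∸ a                               ∎
  where
  open ≡-Reasoning
  upper : kunzUpper a c ≡ suc (c + c)
  upper = m≥n⇒m⊓n≡n (+-mono-≤ c<a (<⇒≤ c<a))
  lower : kunzLower a c ≡ a ∸ suc c
  lower = cong (_⊔ (a ∸ suc c)) (m≤n⇒m∸n≡0 (<⇒≤ c<a))
  e : ∀ c → suc c + suc (suc (c + c)) ≡ c * 3 + 3
  e = solve-∀

kunzCount-above : ∀ {a c} → a ≤ c → kunzCount a c ≡ (a * 3 + 1) ∸ c
kunzCount-above {a} {c} a≤c = begin
  suc (kunzUpper a c) ∸ kunzLower a c      ≡⟨ cong₂ (λ u l → suc u ∸ l) upper lower ⟩
  suc (a + a) ∸ (c ∸ a)                    ≡⟨ sym ([m+n]∸[m+o]≡n∸o a _ _) ⟩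
  (a + suc (a + a)) ∸ (a + (c ∸ a))        ≡⟨ cong₂ _∸_ (e a) (m+[n∸m]≡n a≤c) ⟩
  (a * 3 + 1) ∸ c                          ∎
  where
  open ≡-Reasoning
  upper : kunzUpper a c ≡ a + a
  upper = m≤n⇒m⊓n≡m (≤-trans (+-mono-≤ a≤c a≤c) (n≤1+n (c + c)))
  lower : kunzLower a c ≡ c ∸ a
  lower = trans (cong ((c ∸ a) ⊔_) (m≤n⇒m∸n≡0 (m≤n⇒m≤1+n a≤c))) (⊔-identityʳ (c ∸ a))
  e : ∀ a → a + suc (a + a) ≡ a * 3 + 1
  e = solve-∀

m≡n+o⇒m∸n≡o : ∀ {m} n {o} → m ≡ n + o → m ∸ n ≡ o
m≡n+o⇒m∸n≡o n {o} refl = m+n∸m≡n n o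

-- The part of a row with c < a; the truncated subtraction makes it a quasi-polynomial
-- of period 3, hence the induction in steps of 3 below.
belowA : ℕ → ℕ
belowA a = ∑[ c < a ] ((c * 3 + 3) ∸ a)

belowA-+3 : ∀ a → belowA (3 + a) ≡ belowA a + (a * 4 + 9)
belowA-+3 a = begin
  belowA (3 + a)                                                     ≡⟨ ∑-suc (2 + a) _ ⟩
  (0 ∸ a) + (belowA a + ((a * 3 + 3) ∸ a) + ((suc a * 3 + 3) ∸ a))   ≡⟨ cong₂ _+_ (0∸n≡0 a)
                                                                         (cong₂ _+_ (cong (λ z → belowA a + z) (m≡n+o⇒m∸n≡o a (e₁ a)))
                                                                                    (m≡n+o⇒m∸n≡o a (e₂ a))) ⟩
  belowA a + (a * 2 + 3) + (a * 2 + 6)                               ≡⟨ e₃ (belowA a) a ⟩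
  belowA a + (a * 4 + 9)                                             ∎
  where
  open ≡-Reasoning
  e₁ : ∀ a → a * 3 + 3 ≡ a + (a * 2 + 3)
  e₁ = solve-∀
  e₂ : ∀ a → suc a * 3 + 3 ≡ a + (a * 2 + 6)
  e₂ = solve-∀
  e₃ : ∀ x a → x + (a * 2 + 3) + (a * 2 + 6) ≡ x + (a * 4 + 9)
  e₃ = solve-∀

belowA-bounds : ∀ a → a * a * 2 + a * 3 ≤ belowA a * 3 × belowA a * 3 ≤ a * a * 2 + a * 3 + 1
belowA-bounds 0 = z≤n , z≤n
belowA-bounds 1 = ≤-slack 1 refl , ≤-refl
belowA-bounds 2 = ≤-slack 1 refl , ≤-refl
belowA-bounds (suc (suc (suc a))) =
    subst₂ _≤_ (sym (e₁ a)) (sym step) (+-monoˡ-≤ (a * 12 + 27) (proj₁ (belowA-bounds a)))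
  , subst₂ _≤_ (sym step) (sym (e₂ a)) (+-monoˡ-≤ (a * 12 + 27) (proj₂ (belowA-bounds a)))
  where
  e₁ : ∀ a → (3 + a) * (3 + a) * 2 + (3 + a) * 3 ≡ a * a * 2 + a * 3 + (a * 12 + 27)
  e₁ = solve-∀
  e₂ : ∀ a → (3 + a) * (3 + a) * 2 + (3 + a) * 3 + 1 ≡ a * a * 2 + a * 3 + 1 + (a * 12 + 27)
  e₂ = solve-∀
  e₃ : ∀ x a → (x + (a * 4 + 9)) * 3 ≡ x * 3 + (a * 12 + 27)
  e₃ = solve-∀
  step : belowA (3 + a) * 3 ≡ belowA a * 3 + (a * 12 + 27)
  step = trans (cong (_* 3) (belowA-+3 a)) (e₃ (belowA a) a)

belowC : ℕ → ℕ
belowC c = ∑[ a < suc c ] ((a * 3 + 1) ∸ c)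

belowC-+3 : ∀ c → belowC (3 + c) ≡ belowC c + (c * 4 + 11)
belowC-+3 c = begin
  belowC (3 + c)                                                         ≡⟨ ∑-suc (3 + c) _ ⟩
  belowC c + ((suc c * 3 + 1) ∸ c) + ((suc (suc c) * 3 + 1) ∸ c)          ≡⟨ cong₂ _+_ (cong (λ z → belowC c + z) (m≡n+o⇒m∸n≡o c (e₁ c)))
                                                                                      (m≡n+o⇒m∸n≡o c (e₂ c)) ⟩
  belowC c + (c * 2 + 4) + (c * 2 + 7)                                   ≡⟨ e₃ (belowC c) c ⟩
  belowC c + (c * 4 + 11)                                                ∎
  where
  open ≡-Reasoning
  e₁ : ∀ c → suc c * 3 + 1 ≡ c + (c * 2 + 4)
  e₁ = solve-∀
  e₂ : ∀ c → suc (suc c) * 3 + 1 ≡ c + (c * 2 + 7)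
  e₂ = solve-∀
  e₃ : ∀ x c → x + (c * 2 + 4) + (c * 2 + 7) ≡ x + (c * 4 + 11)
  e₃ = solve-∀

belowC-bounds : ∀ c → c * c * 2 + c * 5 + 2 ≤ belowC c * 3 × belowC c * 3 ≤ c * c * 2 + c * 5 + 3
belowC-bounds 0 = ≤-slack 1 refl , ≤-refl
belowC-bounds 1 = ≤-refl , ≤-slack 1 refl
belowC-bounds 2 = ≤-slack 1 refl , ≤-refl
belowC-bounds (suc (suc (suc c))) =
    subst₂ _≤_ (sym (e₁ c)) (sym step) (+-monoˡ-≤ (c * 12 + 33) (proj₁ (belowC-bounds c)))
  , subst₂ _≤_ (sym step) (sym (e₂ c)) (+-monoˡ-≤ (c * 12 + 33) (proj₂ (belowC-bounds c)))
  where
  e₁ : ∀ c → (3 + c) * (3 + c) * 2 + (3 + c) * 5 + 2 ≡ c * c * 2 + c * 5 + 2 + (c * 12 + 33)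
  e₁ = solve-∀
  e₂ : ∀ c → (3 + c) * (3 + c) * 2 + (3 + c) * 5 + 3 ≡ c * c * 2 + c * 5 + 3 + (c * 12 + 33)
  e₂ = solve-∀
  e₃ : ∀ x c → (x + (c * 4 + 11)) * 3 ≡ x * 3 + (c * 12 + 33)
  e₃ = solve-∀
  step : belowC (3 + c) * 3 ≡ belowC c * 3 + (c * 12 + 33)
  step = trans (cong (_* 3) (belowC-+3 c)) (e₃ (belowC c) c)

rowA : ℕ → ℕ
rowA a = ∑[ c < suc (a * 3) ] kunzCount a c

rowC : ℕ → ℕ
rowC c = ∑[ a < 3 + c * 3 ] kunzCount a c

rowA-split : ∀ a → rowA a ≡ belowA a + ∑[ j < suc (a + a) ] (suc (a + a) ∸ j)
rowA-split a = begin
  ∑[ c < suc (a * 3) ] kunzCount a c                                   ≡⟨ cong (λ n → ∑ n (kunzCount a)) (e a) ⟩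
  ∑[ c < a + suc (a + a) ] kunzCount a c                               ≡⟨ ∑-+ a (suc (a + a)) (kunzCount a) ⟩
  ∑[ c < a ] kunzCount a c + ∑[ j < suc (a + a) ] kunzCount a (a + j)  ≡⟨ cong₂ _+_ (∑-cong a λ c c<a → kunzCount-below c<a)
                                                                                       (∑-cong (suc (a + a)) λ j _ → above j) ⟩
  belowA a + ∑[ j < suc (a + a) ] (suc (a + a) ∸ j)                    ∎
  where
  open ≡-Reasoning
  e : ∀ a → suc (a * 3) ≡ a + suc (a + a)
  e = solve-∀
  e′ : ∀ a → a * 3 + 1 ≡ a + suc (a + a)
  e′ = solve-∀
  above : ∀ j → kunzCount a (a + j) ≡ suc (a + a) ∸ j
  above j = trans (kunzCount-above (m≤m+n a j))
                  (trans (cong (_∸ (a + j)) (e′ a)) ([m+n]∸[m+o]≡n∸o a _ j))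

rowC-split : ∀ c → rowC c ≡ belowC c + ∑[ j < 2 + (c + c) ] ((2 + (c + c)) ∸ j)
rowC-split c = begin
  ∑[ a < 3 + c * 3 ] kunzCount a c                                           ≡⟨ cong (λ n → ∑ n (λ a → kunzCount a c)) (e c) ⟩
  ∑[ a < suc c + (2 + (c + c)) ] kunzCount a c                               ≡⟨ ∑-+ (suc c) (2 + (c + c)) (λ a → kunzCount a c) ⟩
  ∑[ a < suc c ] kunzCount a c + ∑[ j < 2 + (c + c) ] kunzCount (suc c + j) c ≡⟨ cong₂ _+_ (∑-cong (suc c) λ a a<1+c → kunzCount-above (s≤s⁻¹ a<1+c))
                                                                                              (∑-cong (2 + (c + c)) λ j _ → above j) ⟩
  belowC c + ∑[ j < 2 + (c + c) ] ((2 + (c + c)) ∸ j)                        ∎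
  where
  open ≡-Reasoning
  e : ∀ c → 3 + c * 3 ≡ suc c + (2 + (c + c))
  e = solve-∀
  e′ : ∀ c → c * 3 + 3 ≡ suc c + (2 + (c + c))
  e′ = solve-∀
  above : ∀ j → kunzCount (suc c + j) c ≡ (2 + (c + c)) ∸ j
  above j = trans (kunzCount-below (s≤s (m≤m+n c j)))
                  (trans (cong (_∸ (suc c + j)) (e′ c)) ([m+n]∸[m+o]≡n∸o (suc c) _ j))

rowA-bounds : ∀ a → a * a * 8 + a * 12 + 3 ≤ rowA a * 3 × rowA a * 3 ≤ a * a * 8 + a * 12 + 4
rowA-bounds a =
    subst₂ _≤_ (e₁ a) (sym rowA*3) (+-monoˡ-≤ triangle*3 (proj₁ (belowA-bounds a)))
  , subst₂ _≤_ (sym rowA*3) (e₂ a) (+-monoˡ-≤ triangle*3 (proj₂ (belowA-bounds a)))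
  where
  triangle*3 = suc (a + a) * suc a * 3
  half : ∀ a → suc (a + a) * suc (suc (a + a)) ≡ suc (a + a) * suc a * 2
  half = solve-∀
  distrib : ∀ x y → (x + y) * 3 ≡ x * 3 + y * 3
  distrib = solve-∀
  rowA*3 : rowA a * 3 ≡ belowA a * 3 + triangle*3
  rowA*3 = trans (cong (_* 3) (trans (rowA-split a) (cong (λ z → belowA a + z) (triangle-closed (suc (a + a)) (suc (a + a) * suc a) (half a)))))
                 (distrib (belowA a) _)
  e₁ : ∀ a → a * a * 2 + a * 3 + suc (a + a) * suc a * 3 ≡ a * a * 8 + a * 12 + 3
  e₁ = solve-∀
  e₂ : ∀ a → a * a * 2 + a * 3 + 1 + suc (a + a) * suc a * 3 ≡ a * a * 8 + a * 12 + 4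
  e₂ = solve-∀

rowC-bounds : ∀ c → c * c * 8 + c * 20 + 11 ≤ rowC c * 3 × rowC c * 3 ≤ c * c * 8 + c * 20 + 12
rowC-bounds c =
    subst₂ _≤_ (e₁ c) (sym rowC*3) (+-monoˡ-≤ triangle*3 (proj₁ (belowC-bounds c)))
  , subst₂ _≤_ (sym rowC*3) (e₂ c) (+-monoˡ-≤ triangle*3 (proj₂ (belowC-bounds c)))
  where
  triangle*3 = suc c * (3 + (c + c)) * 3
  half : ∀ c → (2 + (c + c)) * suc (2 + (c + c)) ≡ suc c * (3 + (c + c)) * 2
  half = solve-∀
  distrib : ∀ x y → (x + y) * 3 ≡ x * 3 + y * 3
  distrib = solve-∀
  rowC*3 : rowC c * 3 ≡ belowC c * 3 + triangle*3
  rowC*3 = trans (cong (_* 3) (trans (rowC-split c) (cong (λ z → belowC c + z) (triangle-closed (2 + (c + c)) (suc c * (3 + (c + c))) (half c)))))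
                 (distrib (belowC c) _)
  e₁ : ∀ c → c * c * 2 + c * 5 + 2 + suc c * (3 + (c + c)) * 3 ≡ c * c * 8 + c * 20 + 11
  e₁ = solve-∀
  e₂ : ∀ c → c * c * 2 + c * 5 + 3 + suc c * (3 + (c + c)) * 3 ≡ c * c * 8 + c * 20 + 12
  e₂ = solve-∀

private
  24*[x*3]≡72*x : ∀ x → 24 * (x * 3) ≡ 72 * x
  24*[x*3]≡72*x = solve-∀

totalA : ℕ → ℕ
totalA T = ∑[ a < suc T ] rowA a

totalC : ℕ → ℕ
totalC T = ∑[ c < suc T ] rowC c

totalA-bounds : ∀ T → let q = T * 4 + 1 in q ^ 3 ≤ 72 * totalA T × 72 * totalA T ≤ q ^ 3 + 100 * (q * q)
totalA-bounds T = subst (λ s → L T ≤ s × s ≤ U T) (∑-*ˡ (suc T) 72 rowA)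
  (∑-sandwich (λ a → 72 * rowA a) L U (s≤s z≤n) (≤-slack 29 refl) L-step U-step T)
  where
  L U : ℕ → ℕ
  L n = (n * 4 + 1) ^ 3
  U n = (n * 4 + 1) ^ 3 + 100 * ((n * 4 + 1) * (n * 4 + 1))
  L-step : ∀ n → L (suc n) ≤ L n + 72 * rowA (suc n)
  L-step n = begin
    L (suc n)                                                      ≡⟨ e₁ n ⟩
    L n + (n * n * 192 + n * 288 + 124)                            ≤⟨ +-monoʳ-≤ (L n) (≤-slack (n * 384 + 428) (e₂ n)) ⟩
    L n + 24 * (suc n * suc n * 8 + suc n * 12 + 3)                ≤⟨ +-monoʳ-≤ (L n) (*-monoʳ-≤ 24 (proj₁ (rowA-bounds (suc n)))) ⟩
    L n + 24 * (rowA (suc n) * 3)                                  ≡⟨ cong (λ z → L n + z) (24*[x*3]≡72*x (rowA (suc n))) ⟩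
    L n + 72 * rowA (suc n)                                        ∎
    where
    open ≤-Reasoning
    e₁ : ∀ n → let x = suc n * 4 + 1; y = n * 4 + 1 in x * (x * (x * 1)) ≡ y * (y * (y * 1)) + (n * n * 192 + n * 288 + 124)
    e₁ = solve-∀
    e₂ : ∀ n → n * n * 192 + n * 288 + 124 + (n * 384 + 428) ≡ 24 * (suc n * suc n * 8 + suc n * 12 + 3)
    e₂ = solve-∀
  U-step : ∀ n → U n + 72 * rowA (suc n) ≤ U (suc n)
  U-step n = begin
    U n + 72 * rowA (suc n)                                        ≡⟨ cong (λ z → U n + z) (sym (24*[x*3]≡72*x (rowA (suc n)))) ⟩
    U n + 24 * (rowA (suc n) * 3)                                  ≤⟨ +-monoʳ-≤ (U n) (*-monoʳ-≤ 24 (proj₂ (rowA-bounds (suc n)))) ⟩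
    U n + 24 * (suc n * suc n * 8 + suc n * 12 + 4)                ≤⟨ ≤-slack (n * 2816 + 1948) (e₄ n) ⟩
    U (suc n)                                                      ∎
    where
    open ≤-Reasoning
    e₄ : ∀ n → let x = suc n * 4 + 1; y = n * 4 + 1 in
         y * (y * (y * 1)) + 100 * (y * y) + 24 * (suc n * suc n * 8 + suc n * 12 + 4) + (n * 2816 + 1948) ≡ x * (x * (x * 1)) + 100 * (x * x)
    e₄ = solve-∀

totalC-bounds : ∀ T → let q = T * 4 + 3 in q ^ 3 ≤ 72 * totalC T × 72 * totalC T ≤ q ^ 3 + 100 * (q * q)
totalC-bounds T = subst (λ s → L T ≤ s × s ≤ U T) (∑-*ˡ (suc T) 72 rowC)
  (∑-sandwich (λ c → 72 * rowC c) L U (≤-slack 261 refl) (≤-slack 639 refl) L-step U-step T)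
  where
  L U : ℕ → ℕ
  L n = (n * 4 + 3) ^ 3
  U n = (n * 4 + 3) ^ 3 + 100 * ((n * 4 + 3) * (n * 4 + 3))
  L-step : ∀ n → L (suc n) ≤ L n + 72 * rowC (suc n)
  L-step n = begin
    L (suc n)                                                      ≡⟨ e₁ n ⟩
    L n + (n * n * 192 + n * 480 + 316)                            ≤⟨ +-monoʳ-≤ (L n) (≤-slack (n * 384 + 620) (e₂ n)) ⟩
    L n + 24 * (suc n * suc n * 8 + suc n * 20 + 11)               ≤⟨ +-monoʳ-≤ (L n) (*-monoʳ-≤ 24 (proj₁ (rowC-bounds (suc n)))) ⟩
    L n + 24 * (rowC (suc n) * 3)                                  ≡⟨ cong (λ z → L n + z) (24*[x*3]≡72*x (rowC (suc n))) ⟩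
    L n + 72 * rowC (suc n)                                        ∎
    where
    open ≤-Reasoning
    e₁ : ∀ n → let x = suc n * 4 + 3; y = n * 4 + 3 in x * (x * (x * 1)) ≡ y * (y * (y * 1)) + (n * n * 192 + n * 480 + 316)
    e₁ = solve-∀
    e₂ : ∀ n → n * n * 192 + n * 480 + 316 + (n * 384 + 620) ≡ 24 * (suc n * suc n * 8 + suc n * 20 + 11)
    e₂ = solve-∀
  U-step : ∀ n → U n + 72 * rowC (suc n) ≤ U (suc n)
  U-step n = begin
    U n + 72 * rowC (suc n)                                        ≡⟨ cong (λ z → U n + z) (sym (24*[x*3]≡72*x (rowC (suc n)))) ⟩
    U n + 24 * (rowC (suc n) * 3)                                  ≤⟨ +-monoʳ-≤ (U n) (*-monoʳ-≤ 24 (proj₂ (rowC-bounds (suc n)))) ⟩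
    U n + 24 * (suc n * suc n * 8 + suc n * 20 + 12)               ≤⟨ ≤-slack (n * 2816 + 3356) (e₄ n) ⟩
    U (suc n)                                                      ∎
    where
    open ≤-Reasoning
    e₄ : ∀ n → let x = suc n * 4 + 3; y = n * 4 + 3 in
         y * (y * (y * 1)) + 100 * (y * y) + 24 * (suc n * suc n * 8 + suc n * 20 + 12) + (n * 2816 + 3356) ≡ x * (x * (x * 1)) + 100 * (x * x)
    e₄ = solve-∀

N₄ : ℕ → ℕ
N₄ q = length (kunzList q)

N₄-count : ∀ q → Odd q → HasCount (Contains4q q) (N₄ q)
N₄-count q odd = hasCount-fromList (Contains4q q) (kunzList q) (kunzList-unique q) sound complete
  where
  sound : ∀ {t} → t ∈ kunzList q → Contains4q q (semigroupOf t)
  sound {t} t∈ = let kunz , q-large = ∈-kunzList⁻ t∈ in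
    semigroupOf-isNumericalSemigroup t kunz , refl , ∈-semigroupOf⁺ t q q-large
  complete : ∀ H → Contains4q q H → ∃[ t ] t ∈ kunzList q × semigroupOf t ≐ H
  complete H (H-semigroup , 4∈H , q∈H) =
    aperyTriple , ∈-kunzList⁺ (odd⇒%4≡1⊎3 odd) aperyTriple-isKunz (∈⇒apery≤ q q∈H) , semigroupOf-aperyTriple
    where open AperyTriple H-semigroup 4∈H

private
  sandwich⇒approx : ∀ {m q X Y} → m ≡ q → X ≡ Y → m ^ 3 ≤ 72 * Y × 72 * Y ≤ m ^ 3 + 100 * (m * m) →
                    q ^ 3 ≤ 72 * X + 100 * (q * q) × 72 * X ≤ q ^ 3 + 100 * (q * q)
  sandwich⇒approx refl refl (lo , hi) = ≤-trans lo (m≤m+n _ _) , hi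

N₄-cubicApprox : CubicApprox 72 100 N₄
N₄-cubicApprox q odd with q % 4 | division-by-4 q | odd⇒%4≡1⊎3 odd
... | 0      | _  | inj₁ ()
... | 1      | q≡ | _ = sandwich⇒approx q≡ (length-kunzTriplesA (q div 4)) (totalA-bounds (q div 4))
... | 2      | _  | inj₁ ()
... | 3      | q≡ | _ = sandwich⇒approx q≡ (length-kunzTriplesC (q div 4)) (totalC-bounds (q div 4))
... | 4+ _   | _  | inj₁ ()

injective⇒surjective : ∀ {n} {f : Fin n → Fin n} → Injective _≡_ _≡_ f → ∀ i → ∃[ k ] f k ≡ i
injective⇒surjective {suc n} {f} f-inj i with any? (λ k → f k Fin.≟ i)
... | yes hit  = hit
... | no  miss = contradiction (injective⇒≤ punchOut-inj) (<-irrefl refl)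
  where
  -- A missed value i makes k ↦ punchOut (i ≢ f k) an injection Fin (suc n) → Fin n.
  i≢f : ∀ k → i ≢ f k
  i≢f k i≡fk = miss (k , sym i≡fk)
  punchOut-inj : Injective _≡_ _≡_ (λ k → punchOut (i≢f k))
  punchOut-inj eq = f-inj (punchOut-injective (i≢f _) (i≢f _) eq)

shift : Triple → Triple
shift (a , b , c) = suc a , suc b , suc c

apery-shift≤ : ∀ s r → apery (shift s) r ≤ 4 + apery s r
apery-shift≤ s 0      = z≤n
apery-shift≤ s 1      = ≤-refl
apery-shift≤ s 2      = ≤-refl
apery-shift≤ s 3      = ≤-refl
apery-shift≤ s (4+ _) = z≤n

apery-shift-odd : ∀ s {r} → r ≡ 1 ⊎ r ≡ 3 → apery (shift s) r ≡ 4 + apery s r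
apery-shift-odd s (inj₁ refl) = refl
apery-shift-odd s (inj₂ refl) = refl

isKunz-shift : ∀ {s} → IsKunz s → IsKunz (shift s)
isKunz-shift {a , b , c} (b≤2a , c≤a+b , a≤b+c+1 , b≤2c+1) =
    s≤s (≤-trans b≤2a (+-monoʳ-≤ a (n≤1+n a)))
  , s≤s (≤-trans c≤a+b (+-monoʳ-≤ a (n≤1+n b)))
  , s≤s (≤-trans a≤b+c+1 (s≤s (+-monoʳ-≤ b (n≤1+n c))))
  , s≤s (≤-trans b≤2c+1 (s≤s (+-monoʳ-≤ c (n≤1+n c))))

-- Multiplicity 4 means that 4a+1, 4b+2 and 4c+3 are all at least 4.
multiplicity4⇒shifted : ∀ t → (∀ x → x ∈ₛ semigroupOf t → x ≢ 0 → 4 ≤ x) → ∃[ s ] t ≡ shift s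
multiplicity4⇒shifted (suc a , suc b , suc c) _ = (a , b , c) , refl
multiplicity4⇒shifted t@(0 , _ , _) mult with mult 1 (apery-∈ t 1<4) (λ ())
... | s≤s ()
multiplicity4⇒shifted t@(suc _ , 0 , _) mult with mult 2 (apery-∈ t 2<4) (λ ())
... | s≤s (s≤s ())
multiplicity4⇒shifted t@(suc _ , suc _ , 0) mult with mult 3 (apery-∈ t 3<4) (λ ())
... | s≤s (s≤s (s≤s ()))

-- The minimal generators of a semigroup with multiplicity 4 lie among
-- 4 and the three nonzero Apéry elements, i.e. among 4 + apery s r.
module Generators {H : SubsetℕB} (s : Triple) (H≐ : semigroupOf (shift s) ≐ H) where

  generator : ℕ → ℕ
  generator r = 4 + apery s r

  generator≤⇒∈ : ∀ x → generator (x % 4) ≤ x → x ∈ₛ H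
  generator≤⇒∈ x le = trans (sym (H≐ x)) (∈-semigroupOf⁺ (shift s) x (≤-trans (apery-shift≤ s (x % 4)) le))

  ∈⇒generator≤ : ∀ x → x ∈ₛ H → x ≢ 0 → generator (x % 4) ≤ x
  ∈⇒generator≤ x x∈ x≢0 with x % 4 | division-by-4 x | ∈-semigroupOf⁻ (shift s) x (trans (H≐ x) x∈) | m%n<n x 4
  ... | 0 | x≡ | _ | _ = nonzero-multiple (x div 4) x≡
    where
    nonzero-multiple : ∀ k → k * 4 + 0 ≡ x → 4 ≤ x
    nonzero-multiple 0       refl = contradiction refl x≢0
    nonzero-multiple (suc k) refl = m≤m+n 4 (k * 4 + 0)
  ... | 1 | _ | le | _ = le
  ... | 2 | _ | le | _ = le
  ... | 3 | _ | le | _ = le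
  ... | 4+ _ | _ | _ | s≤s (s≤s (s≤s (s≤s ())))

  generator-%4 : ∀ {i} → i < 4 → generator i % 4 ≡ i
  generator-%4 = apery-%4 s

  generator-∈ : ∀ {i} → i < 4 → generator i ∈ₛ H
  generator-∈ {i} i<4 = generator≤⇒∈ (generator i) (≤-reflexive (cong generator (generator-%4 i<4)))

  multiplicity : Multiplicity H 4
  multiplicity = generator≤⇒∈ 4 ≤-refl , (λ ()) , λ x x∈ x≢0 → ≤-trans (m≤m+n 4 _) (∈⇒generator≤ x x∈ x≢0)

  minGen⇒≡generator : ∀ x → IsMinGen H x → x ≡ generator (x % 4)
  minGen⇒≡generator x (x∈ , x≢0 , not-sum)
    with ≡%4⇒multiple-of-4-apart (generator-%4 (m%n<n x 4)) (∈⇒generator≤ x x∈ x≢0)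
  ... | 0     , x≡ = x≡
  ... | suc k , x≡ = contradiction (sym x≡) (not-sum 4 y (generator≤⇒∈ 4 ≤-refl) y∈ (λ ()) (m+1+n≢0 (k * 4)))
    where
    g = generator (x % 4)
    y = k * 4 + g
    y∈ : y ∈ₛ H
    y∈ = generator≤⇒∈ y (subst (λ r → generator r ≤ y)
           (sym (trans (%4-+multiple k g) (generator-%4 (m%n<n x 4)))) (m≤n+m g (k * 4)))

  -- Subadditivity of s is strict subadditivity (by 4) of the generators.
  sum-bound : SubadditiveApery s → ∀ x y → x ∈ₛ H → y ∈ₛ H → x ≢ 0 → y ≢ 0 → generator ((x + y) % 4) + 4 ≤ x + y
  sum-bound sub x y x∈ y∈ x≢0 y≢0 = begin
    generator ((x + y) % 4) + 4                    ≡⟨ cong (λ r → generator r + 4) (%-distribˡ-+ x y 4) ⟩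
    4 + apery s ((x % 4 + y % 4) % 4) + 4          ≤⟨ +-monoˡ-≤ 4 (+-monoʳ-≤ 4 (sub (x % 4) (y % 4) (m%n<n x 4) (m%n<n y 4))) ⟩
    4 + (apery s (x % 4) + apery s (y % 4)) + 4    ≡⟨ e (apery s (x % 4)) (apery s (y % 4)) ⟩
    generator (x % 4) + generator (y % 4)          ≤⟨ +-mono-≤ (∈⇒generator≤ x x∈ x≢0) (∈⇒generator≤ y y∈ y≢0) ⟩
    x + y                                          ∎
    where
    open ≤-Reasoning
    e : ∀ u v → 4 + (u + v) + 4 ≡ (4 + u) + (4 + v)
    e = solve-∀

  subadditive⇒minGen : SubadditiveApery s → ∀ {i} → i < 4 → IsMinGen H (generator i)
  subadditive⇒minGen sub {i} i<4 = generator-∈ i<4 , (λ ()) , λ a b a∈ b∈ a≢0 b≢0 a+b≡g →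
    m+1+n≰m (generator i) (subst (λ r → generator r + 4 ≤ generator i) (generator-%4 i<4)
      (subst (λ z → generator (z % 4) + 4 ≤ z) a+b≡g (sum-bound sub a b a∈ b∈ a≢0 b≢0)))

  minGen⇒subadditive : IsNumericalSemigroup H → (∀ {i} → i < 4 → IsMinGen H (generator i)) → SubadditiveApery s
  minGen⇒subadditive H-semigroup allMin i j i<4 j<4 =
    +-cancelˡ-≤ 8 _ _ (subst₂ _≤_ (e₁ (apery s r)) (e₂ (apery s i) (apery s j)) gap)
    where
    open IsNumericalSemigroup H-semigroup using (+-closed)
    r = (i + j) % 4
    x = generator i + generator j
    x%4 : x % 4 ≡ r
    x%4 = trans (%-distribˡ-+ (generator i) (generator j) 4) (cong₂ (λ u v → (u + v) % 4) (generator-%4 i<4) (generator-%4 j<4))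
    g≤x : generator r ≤ x
    g≤x = subst (λ r → generator r ≤ x) x%4 (∈⇒generator≤ x (+-closed _ _ (generator-∈ i<4) (generator-∈ j<4)) (λ ()))
    gap : generator r + 4 ≤ x
    gap with ≡%4⇒multiple-of-4-apart (trans (generator-%4 (m%n<n (i + j) 4)) (sym x%4)) g≤x
    ... | 0     , x≡g = contradiction x≡g
                          (proj₂ (proj₂ (allMin (m%n<n (i + j) 4))) _ _ (generator-∈ i<4) (generator-∈ j<4) (λ ()) (λ ()))
    ... | suc k , x≡  = subst (generator r + 4 ≤_) (sym x≡)
                          (subst (_≤ suc k * 4 + generator r) (+-comm 4 (generator r)) (+-monoˡ-≤ (generator r) (m≤m+n 4 (k * 4))))
    e₁ : ∀ u → 4 + u + 4 ≡ 8 + u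
    e₁ = solve-∀
    e₂ : ∀ u v → (4 + u) + (4 + v) ≡ 8 + (u + v)
    e₂ = solve-∀

  allMinGen⇒embDim4 : (∀ {i} → i < 4 → IsMinGen H (generator i)) → EmbDim H 4
  allMinGen⇒embDim4 allMin =
      gens
    , (λ i j eq → toℕ-injective (trans (sym (residue i)) (trans (cong (_% 4) eq) (residue j))))
    , (λ i → subst (IsMinGen H) (sym (lookup∘tabulate gen i)) (allMin (toℕ<n i)))
    , λ x x-min → fromℕ< (m%n<n x 4) , (begin
        Vec.lookup gens (fromℕ< (m%n<n x 4))   ≡⟨ lookup∘tabulate gen (fromℕ< (m%n<n x 4)) ⟩
        generator (toℕ (fromℕ< (m%n<n x 4))) ≡⟨ cong generator (toℕ-fromℕ< (m%n<n x 4)) ⟩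
        generator (x % 4)                  ≡⟨ sym (minGen⇒≡generator x x-min) ⟩
        x                                  ∎)
    where
    open ≡-Reasoning
    gen : Fin 4 → ℕ
    gen k = generator (toℕ k)
    gens = Vec.tabulate gen
    residue : ∀ k → Vec.lookup gens k % 4 ≡ toℕ k
    residue k = trans (cong (_% 4) (lookup∘tabulate gen k)) (generator-%4 (toℕ<n k))

  -- Four distinct minimal generators have four distinct residues, so every residue is hit.
  embDim4⇒allMinGen : EmbDim H 4 → ∀ {i} → i < 4 → IsMinGen H (generator i)
  embDim4⇒allMinGen (gens , distinct , minimal , _) {i} i<4 =
    let k , residue≡i = injective⇒surjective residue-injective (fromℕ< i<4) in
    subst (IsMinGen H) (trans (minGen⇒≡generator _ (minimal k))
      (cong generator (trans (toℕ-residue residue≡i) (toℕ-fromℕ< i<4)))) (minimal k)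
    where
    residue : Fin 4 → Fin 4
    residue k = fromℕ< (m%n<n (Vec.lookup gens k) 4)
    toℕ-residue : ∀ {k l} → residue k ≡ l → Vec.lookup gens k % 4 ≡ toℕ l
    toℕ-residue refl = sym (toℕ-fromℕ< _)
    residue-injective : Injective _≡_ _≡_ residue
    residue-injective {k} {l} eq = distinct k l (begin
      Vec.lookup gens k                       ≡⟨ minGen⇒≡generator _ (minimal k) ⟩
      generator (Vec.lookup gens k % 4)       ≡⟨ cong generator (trans (toℕ-residue eq) (toℕ-fromℕ< _)) ⟩
      generator (Vec.lookup gens l % 4)       ≡⟨ minGen⇒≡generator _ (minimal l) ⟨
      Vec.lookup gens l                       ∎)
      where open ≡-Reasoning

medimList : ℕ → List Triple
medimList (4+ q) = map shift (kunzList q)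
medimList _      = []

Medim₄ : ℕ → ℕ
Medim₄ q = length (medimList q)

medimList-unique : ∀ q → Unique (medimList q)
medimList-unique (4+ q) = Unique.map⁺ shift-injective (kunzList-unique q)
  where
  shift-injective : ∀ {s s'} → shift s ≡ shift s' → s ≡ s'
  shift-injective {_ , _ , _} {_ , _ , _} refl = refl
medimList-unique 0 = Unique.[]
medimList-unique 1 = Unique.[]
medimList-unique 2 = Unique.[]
medimList-unique 3 = Unique.[]

Medim₄-count : ∀ q → Odd q → HasCount (Medim4q q) (Medim₄ q)
Medim₄-count q odd = hasCount-fromList (Medim4q q) (medimList q) (medimList-unique q) (sound q) complete
  where
  sound : ∀ q {t} → t ∈ medimList q → Medim4q q (semigroupOf t)
  sound (4+ q) t∈ with ∈-map⁻ shift t∈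
  ... | s@(_ , _ , _) , s∈ , refl =
    let kunz , q-large = ∈-kunzList⁻ s∈ in
      ( semigroupOf-isNumericalSemigroup (shift s) (isKunz-shift kunz) , refl
      , ∈-semigroupOf⁺ (shift s) (4+ q) (≤-trans (apery-shift≤ s (q % 4)) (+-monoʳ-≤ 4 q-large)))
    , multiplicity , allMinGen⇒embDim4 (subadditive⇒minGen (isKunz⇒subadditive s kunz))
    where open Generators s (λ _ → refl)
  complete : ∀ H → Medim4q q H → ∃[ t ] t ∈ medimList q × semigroupOf t ≐ H
  complete H ((H-semigroup , 4∈H , q∈H) , (_ , _ , mult) , embDim) =
    shift s , place q (odd⇒%4≡1⊎3 odd) q-large , H≐
    where
    open AperyTriple H-semigroup 4∈H
    shifted = multiplicity4⇒shifted aperyTriple λ x x∈ → mult x (trans (sym (semigroupOf-aperyTriple x)) x∈)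
    s = proj₁ shifted
    H≐ : semigroupOf (shift s) ≐ H
    H≐ = subst (λ t → semigroupOf t ≐ H) (proj₂ shifted) semigroupOf-aperyTriple
    open Generators s H≐
    kunz : IsKunz s
    kunz = subadditive⇒isKunz s (minGen⇒subadditive H-semigroup (embDim4⇒allMinGen embDim))
    q-large : 4 + apery s (q % 4) ≤ q
    q-large = subst (_≤ q) (apery-shift-odd s (odd⇒%4≡1⊎3 odd))
                (subst (λ t → apery t (q % 4) ≤ q) (proj₂ shifted) (∈⇒apery≤ q q∈H))
    -- The bound 4 + apery s r ≤ q rules out q < 4.
    place : ∀ q → q % 4 ≡ 1 ⊎ q % 4 ≡ 3 → 4 + apery s (q % 4) ≤ q → shift s ∈ medimList q
    place (4+ q) odd (s≤s (s≤s (s≤s (s≤s le)))) = ∈-map⁺ shift (∈-kunzList⁺ odd kunz le)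

odd-4+ : ∀ {p} → Odd (4+ p) → Odd p
odd-4+ (suc (suc k) , eq) = k , cong (_∸ 4) (trans eq (e k))
  where
  e : ∀ k → suc (2 * suc (suc k)) ≡ 4 + suc (2 * k)
  e = solve-∀

Medim₄-cubicApprox : CubicApprox 72 200 Medim₄
Medim₄-cubicApprox 0 _ = z≤n , z≤n
Medim₄-cubicApprox 1 _ = ≤-slack 199 refl , z≤n
Medim₄-cubicApprox 2 _ = ≤-slack 792 refl , z≤n
Medim₄-cubicApprox 3 _ = ≤-slack 1773 refl , z≤n
Medim₄-cubicApprox (4+ p) odd = lower , upper
  where
  open ≤-Reasoning
  Medim₄≡N₄ : Medim₄ (4+ p) ≡ N₄ p
  Medim₄≡N₄ = length-map shift (kunzList p)
  approx = N₄-cubicApprox p (odd-4+ odd)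
  lower : (4 + p) ^ 3 ≤ 72 * Medim₄ (4+ p) + 200 * ((4 + p) * (4 + p))
  lower = begin
    (4 + p) ^ 3                                              ≡⟨ e₁ p ⟩
    p ^ 3 + (p * p * 12 + p * 48 + 64)                       ≤⟨ +-monoˡ-≤ _ (proj₁ approx) ⟩
    72 * N₄ p + 100 * (p * p) + (p * p * 12 + p * 48 + 64)   ≤⟨ ≤-slack (p * p * 88 + p * 1552 + 3136) (e₂ (N₄ p) p) ⟩
    72 * N₄ p + 200 * ((4 + p) * (4 + p))                    ≡⟨ cong (λ n → 72 * n + 200 * ((4 + p) * (4 + p))) Medim₄≡N₄ ⟨
    72 * Medim₄ (4+ p) + 200 * ((4 + p) * (4 + p))           ∎
    where
    e₁ : ∀ p → (4 + p) * ((4 + p) * ((4 + p) * 1)) ≡ p * (p * (p * 1)) + (p * p * 12 + p * 48 + 64)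
    e₁ = solve-∀
    e₂ : ∀ n p → 72 * n + 100 * (p * p) + (p * p * 12 + p * 48 + 64) + (p * p * 88 + p * 1552 + 3136) ≡ 72 * n + 200 * ((4 + p) * (4 + p))
    e₂ = solve-∀
  upper : 72 * Medim₄ (4+ p) ≤ (4 + p) ^ 3 + 200 * ((4 + p) * (4 + p))
  upper = begin
    72 * Medim₄ (4+ p)                         ≡⟨ cong (72 *_) Medim₄≡N₄ ⟩
    72 * N₄ p                                  ≤⟨ proj₂ approx ⟩
    p ^ 3 + 100 * (p * p)                      ≤⟨ ≤-slack (p * p * 112 + p * 1648 + 3264) (e p) ⟩
    (4 + p) ^ 3 + 200 * ((4 + p) * (4 + p))    ∎
    where
    e : ∀ p → p * (p * (p * 1)) + 100 * (p * p) + (p * p * 112 + p * 1648 + 3264) ≡ (4 + p) * ((4 + p) * ((4 + p) * 1)) + 200 * ((4 + p) * (4 + p))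
    e = solve-∀

proposition6p2 : Σ (ℕ → ℕ) λ N → Σ (ℕ → ℕ) λ M →
    ((∀ q → Odd q → HasCount (Contains4q q) (N q)) ×
     (∀ q → Odd q → HasCount (Medim4q q) (M q)) ×
     OddLimit (λ q → ratio (N q) (q ^ 3)) ((+ 1) / 72) ×
     OddLimit (λ q → ratio (M q) (q ^ 3)) ((+ 1) / 72))
proposition6p2 =
  N₄ , Medim₄ , N₄-count , Medim₄-count ,
  cubicApprox⇒oddLimit 71 100 N₄ N₄-cubicApprox ,
  cubicApprox⇒oddLimit 71 200 Medim₄ Medim₄-cubicApprox
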